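{- For all integers $n \geq 8$, the tortoise complexity of the paperfolding word satisfies $\rho_{\mathbf{f}}^{\textsf{t}}(n) = 4n$.
   Context: "Subword" means factor (contiguous block). The paperfolding word is $\mathbf{f} = f_1 f_2 f_3 \cdots$ where, for a positive integer $n = n' 2^{k}$ with $n'$ odd, $f_n = 0$ if $n' \equiv 1 \pmod 4$ and $f_n = 1$ if $n' \equiv 3 \pmod 4$. The Defant–Kravitz map $\textsf{tortoise}$ on finite words over a totally ordered alphabet (here $0<1$) is defined recursively: $\textsf{tortoise}(\varepsilon)=\varepsilon$; for a nonempty word $w$ whose largest letter $n$ occurs $k$ times, write $w = A_1 n A_2 n \cdots n A_{k+1}$ (each $A_i$ possibly empty, with all letters of $A_i$ smaller than $n$), and set $\textsf{tortoise}(w) = \textsf{tortoise}(A_1)\,\textsf{tortoise}(A_2)\, n\, \textsf{tortoise}(A_3)\, n \cdots n\, \textsf{tortoise}(A_k)\, n\, \textsf{tortoise}(A_{k+1})\, n$. Two words are tortoise-equivalent ($w\sim_{\textsf{t}} v$) if $\textsf{tortoise}(w)=\textsf{tortoise}(v)$. For an infinite word $\mathbf{x}$, $\rho_{\mathbf{x}}^{\textsf{t}}(n)$ is the number of $\sim_{\textsf{t}}$-equivalence classes of the set of length-$n$ subwords of $\mathbf{x}$. -}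

module Defs where

open import Data.Nat using (ℕ; zero; suc; _+_; _*_; _⊔_; _≡ᵇ_; _%_; _/_)
open import Data.Bool using (Bool; true; false; if_then_else_)
open import Data.List using (List; []; _∷_; _++_; [_]; length; map; foldr; concatMap)

-- Words over the totally ordered alphabet ℕ (the paperfolding word uses letters 0 < 1).
Word : Set
Word = List ℕ

-- largest letter of a word (only used for nonempty words)
maxLetter : Word → ℕ
maxLetter = foldr _⊔_ 0

-- split w at every occurrence of the letter n: w = A₁ n A₂ n ⋯ n A_{k+1}
-- returns the list [A₁, …, A_{k+1}] (k+1 blocks, each possibly empty)
splitOn : ℕ → Word → List Word
splitOn n [] = [] ∷ []
splitOn n (x ∷ w) with x ≡ᵇ n | splitOn n w
... | true  | bs       = [] ∷ bs
... | false | []       = (x ∷ []) ∷ []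
... | false | (b ∷ bs) = (x ∷ b) ∷ bs

-- tortoise with a fuel argument (fuel = length suffices: every block is shorter)
tortoiseF : ℕ → Word → Word
tortoiseF zero    w  = w
tortoiseF (suc k) [] = []
tortoiseF (suc k) w@(_ ∷ _) with splitOn (maxLetter w) w
... | []       = []   -- impossible: splitOn always returns ≥ 1 block
... | A₁ ∷ As  = tortoiseF k A₁ ++ concatMap (λ A → tortoiseF k A ++ [ maxLetter w ]) As

-- The Defant–Kravitz map:
-- tortoise(A₁ n A₂ n ⋯ n A_{k+1}) = t(A₁) t(A₂) n t(A₃) n ⋯ n t(A_{k+1}) n
tortoise : Word → Word
tortoise w = tortoiseF (length w) w

-- odd part of a positive integer (fuel-based; fuel m is enough)
oddPartF : ℕ → ℕ → ℕ
oddPartF zero    m = m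
oddPartF (suc k) zero = zero
oddPartF (suc k) (suc m) with (suc m) % 2
... | zero = oddPartF k (suc m / 2)
... | suc _ = suc m

oddPart : ℕ → ℕ
oddPart m = oddPartF m m

-- paperfolding word f = f₁ f₂ f₃ ⋯ (indexed from 1):
-- f_m = 0 if odd part of m ≡ 1 mod 4, and 1 if ≡ 3 mod 4
paperfolding : ℕ → ℕ
paperfolding m = if (oddPart m % 4) ≡ᵇ 1 then 0 else 1

factor : {A : Set} → (ℕ → A) → ℕ → ℕ → List A
factor x i zero    = []
factor x i (suc n) = x i ∷ factor x (suc i) n

_∼t_ : Word → Word → Set
w ∼t v = tortoise w ≡ tortoise v
  where open import Relation.Binary.PropositionalEquality using (_≡_)

{-# OPTIONS --safe #-}
-- Mark each factor f[i .. i+n) with the parity of its starting position i. Since f(2i) = f(i)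
-- and f(2i+1) is 0 or 1 as i is even or odd, a marked factor of length n starting at an odd
-- (even) position is the interleaving of an alternating word fixed by the parity with a
-- marked factor of length ⌊n/2⌋ (⌈n/2⌉), and this correspondence is bijective; so by
-- induction there are exactly 4n marked factors of every length n ≥ 1.
-- On a binary word containing a 1, tortoise deletes the first 1 and appends a 1. Every
-- factor of length 8 contains a 1, and a finite check over the 32 representatives shows that
-- at length 8 the tortoise image determines the marked factor. A factor of length 8 + k
-- is mapped to (its length-8 prefix with the first 1 deleted) · (the remaining k letters) · 1,
-- so the same holds for all n ≥ 8, and the tortoise classes correspond to the 4n marked factors.
module Submission where

open import Defs
open import Data.Bool using (true; false; T; if_then_else_)
open import Data.Empty using (⊥-elim)
open import Data.List using (List; []; _∷_; _++_; [_]; _∷ʳ_; length; map; concatMap)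
open import Data.List.Membership.Propositional using (_∈_)
open import Data.List.Membership.Propositional.Properties using (∈-map⁺; ∈-map⁻; ∈-++⁺ˡ; ∈-++⁺ʳ)
open import Data.List.Properties
  using (∷-injective; ∷-injectiveˡ; ∷ʳ-injectiveˡ; ++-conicalʳ; map-id-local; map-++; map-∘; concatMap-map;
         length-++; length-map)
  renaming (≡-dec to List-≡-dec)
open import Data.List.Relation.Unary.All as All using (All; []; _∷_)
import Data.List.Relation.Unary.All.Properties as AllP
open import Data.List.Relation.Unary.AllPairs using ([]; _∷_)
open import Data.List.Relation.Unary.Any using (here; there)
open import Data.List.Relation.Unary.Unique.DecPropositional using (unique?)
open import Data.List.Relation.Unary.Unique.Propositional using (Unique)
import Data.List.Relation.Unary.Unique.Propositional.Properties as UniqueP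
open import Data.Nat
  using (ℕ; zero; suc; pred; _≤_; _<_; _*_; _+_; _%_; _/_; _≡ᵇ_; z≤n; s≤s; ⌊_/2⌋; ⌈_/2⌉; parity)
import Data.Nat as ℕ
open import Data.List.Membership.DecPropositional ℕ._≟_ using (_∈?_)
open import Data.Nat.DivMod using (m/n<m; [m+kn]%n≡m%n; [m+n]%n≡m%n; m*n%n≡0; m*n/n≡m)
open import Data.Nat.Induction using (<-wellFounded)
open import Data.Nat.Properties
  using (≤-refl; ≤-trans; n≤1+n; suc-injective; +-comm; +-suc; *-distribˡ-+; ⊔-lub; m≥n⇒m⊔n≡m;
         ≡ᵇ⇒≡; ≡⇒≡ᵇ; ⌊n/2⌋<n; ⌈n/2⌉<n; ⌊n/2⌋+⌈n/2⌉≡n; m≤n⇒∃[o]m+o≡n)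
open import Data.Parity.Base using (Parity; 0ℙ; 1ℙ; _⁻¹)
import Data.Parity.Properties as ℙ
open import Data.Product using (Σ; ∃; _×_; _,_; proj₁; proj₂)
open import Data.Product.Properties using () renaming (≡-dec to ×-≡-dec)
open import Data.Unit using (tt)
open import Function using (_∘_; _⇔_; mk⇔; Equivalence)
open import Induction.WellFounded using (Acc; acc)
open import Relation.Binary.Definitions using (DecidableEquality)
open import Relation.Binary.PropositionalEquality hiding ([_])
open import Relation.Nullary using (¬_; Dec; contradiction)
open import Relation.Nullary.Decidable using (from-yes; _→-dec_)

double : ℕ → ℕ
double zero    = zero
double (suc n) = suc (suc (double n))

double≡n*2 : ∀ n → double n ≡ n * 2
double≡n*2 zero    = refl
double≡n*2 (suc n) = cong (suc ∘ suc) (double≡n*2 n)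

n≤double : ∀ n → n ≤ double n
n≤double zero    = z≤n
n≤double (suc n) = s≤s (≤-trans (n≤double n) (n≤1+n _))

double%2≡0 : ∀ n → double n % 2 ≡ 0
double%2≡0 n = trans (cong (_% 2) (double≡n*2 n)) (m*n%n≡0 n 2)

double/2≡n : ∀ n → double n / 2 ≡ n
double/2≡n n = trans (cong (_/ 2) (double≡n*2 n)) (m*n/n≡m n 2)

suc-double%2≡1 : ∀ n → suc (double n) % 2 ≡ 1
suc-double%2≡1 n = trans (cong (λ m → suc m % 2) (double≡n*2 n)) ([m+kn]%n≡m%n 1 n 2)

data HalfView : ℕ → Set where
  odd  : ∀ d → HalfView (suc (double d))
  even : ∀ d → HalfView (double d)

halfView : ∀ n → HalfView n
halfView zero          = even zero
halfView (suc zero)    = odd zero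
halfView (suc (suc n)) with halfView n
... | odd d  = odd (suc d)
... | even d = even (suc d)

parity-double : ∀ n → parity (double n) ≡ 0ℙ
parity-double zero    = refl
parity-double (suc n) = parity-double n

parity-suc-double : ∀ n → parity (suc (double n)) ≡ 1ℙ
parity-suc-double zero    = refl
parity-suc-double (suc n) = parity-suc-double n

parity-suc-cong : ∀ {m n} → parity m ≡ parity n → parity (suc m) ≡ parity (suc n)
parity-suc-cong {m} {n} eq = ℙ.⁻¹-injective (trans (ℙ.suc-homo-⁻¹ m) (trans eq (sym (ℙ.suc-homo-⁻¹ n))))

parity-suc-injective : ∀ {m n} → parity (suc m) ≡ parity (suc n) → parity m ≡ parity n
parity-suc-injective {m} {n} eq = trans (sym (ℙ.suc-homo-⁻¹ m)) (trans (cong _⁻¹ eq) (ℙ.suc-homo-⁻¹ n))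

bit : Parity → ℕ
bit 0ℙ = 0
bit 1ℙ = 1

bit-injective : ∀ {p q} → bit p ≡ bit q → p ≡ q
bit-injective {0ℙ} {0ℙ} _ = refl
bit-injective {1ℙ} {1ℙ} _ = refl

suc-double%4 : ∀ n → suc (double n) % 4 ≡ suc (double (bit (parity n)))
suc-double%4 zero          = refl
suc-double%4 (suc zero)    = refl
suc-double%4 (suc (suc n)) =
  trans (cong (_% 4) (+-comm 4 (suc (double n)))) (trans ([m+n]%n≡m%n (suc (double n)) 4) (suc-double%4 n))

-- Self-similarity of the paperfolding word

oddPartF-fuel : ∀ {k k′} m → m ≤ k → m ≤ k′ → oddPartF k m ≡ oddPartF k′ m
oddPartF-fuel {zero}  {zero}   zero    _         _          = refl
oddPartF-fuel {zero}  {suc _}  zero    _         _          = refl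
oddPartF-fuel {suc _} {zero}   zero    _         _          = refl
oddPartF-fuel {suc _} {suc _}  zero    _         _          = refl
oddPartF-fuel {suc k} {suc k′} (suc m) (s≤s m≤k) (s≤s m≤k′) with suc m % 2
... | zero  = oddPartF-fuel (suc m / 2) (≤-trans half≤m m≤k) (≤-trans half≤m m≤k′)
  where
  half≤m : suc m / 2 ≤ m
  half≤m with m/n<m (suc m) 2 (s≤s (s≤s z≤n))
  ... | s≤s h = h
... | suc _ = refl

oddPart-suc-double : ∀ n → oddPart (suc (double n)) ≡ suc (double n)
oddPart-suc-double n rewrite suc-double%2≡1 n = refl

oddPart-double : ∀ n → oddPart (double (suc n)) ≡ oddPart (suc n)
oddPart-double n rewrite double%2≡0 (suc n) | double/2≡n (suc n) =
  oddPartF-fuel (suc n) (s≤s (n≤double n)) ≤-refl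

paperfolding-double : ∀ n → paperfolding (double n) ≡ paperfolding n
paperfolding-double zero    = refl
paperfolding-double (suc n) = cong (λ m → if m % 4 ≡ᵇ 1 then 0 else 1) (oddPart-double n)

paperfolding-suc-double : ∀ n → paperfolding (suc (double n)) ≡ bit (parity n)
paperfolding-suc-double n = begin
  paperfolding (suc (double n))
    ≡⟨ cong (λ m → if m % 4 ≡ᵇ 1 then 0 else 1) (oddPart-suc-double n) ⟩
  (if suc (double n) % 4 ≡ᵇ 1 then 0 else 1)
    ≡⟨ cong (λ r → if r ≡ᵇ 1 then 0 else 1) (suc-double%4 n) ⟩
  (if suc (double (bit (parity n))) ≡ᵇ 1 then 0 else 1)
    ≡⟨ by-parity (parity n) ⟩
  bit (parity n) ∎
  where
  open ≡-Reasoning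
  by-parity : ∀ p → (if suc (double (bit p)) ≡ᵇ 1 then 0 else 1) ≡ bit p
  by-parity 0ℙ = refl
  by-parity 1ℙ = refl

paperfolding≤1 : ∀ n → paperfolding n ≤ 1
paperfolding≤1 n with oddPart n % 4 ≡ᵇ 1
... | true  = z≤n
... | false = s≤s z≤n

-- Factors of interleaved sequences

module _ {A : Set} where

  length-factor : ∀ (x : ℕ → A) i n → length (factor x i n) ≡ n
  length-factor x i zero    = refl
  length-factor x i (suc n) = cong suc (length-factor x (suc i) n)

  factor-+ : ∀ (x : ℕ → A) i m n → factor x i (m + n) ≡ factor x i m ++ factor x (m + i) n
  factor-+ x i zero    n = refl
  factor-+ x i (suc m) n =
    cong (x i ∷_) (trans (factor-+ x (suc i) m n) (cong (λ j → factor x (suc i) m ++ factor x j n) (+-suc m i)))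

  All-factor : ∀ {P : A → Set} {x : ℕ → A} → (∀ i → P (x i)) → ∀ i n → All P (factor x i n)
  All-factor Px i zero    = []
  All-factor Px i (suc n) = Px i ∷ All-factor Px (suc i) n

  interleave : List A → List A → List A
  interleave []       ys = ys
  interleave (x ∷ xs) ys = x ∷ interleave ys xs

  interleave-injective : ∀ {xs xs′ ys ys′ : List A} → length xs ≡ length xs′ → length ys ≡ length ys′ →
    interleave xs ys ≡ interleave xs′ ys′ → xs ≡ xs′ × ys ≡ ys′
  interleave-injective {[]}    {[]}      _    _    eq = refl , eq
  interleave-injective {x ∷ _} {x′ ∷ _} |xs| |ys| eq with ∷-injective eq
  ... | x≡x′ , rest with interleave-injective |ys| (suc-injective |xs|) rest
  ...   | ys≡ys′ , xs≡xs′ = cong₂ _∷_ x≡x′ xs≡xs′ , ys≡ys′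

  interleave-factor-injective : ∀ {x y : ℕ → A} {i i′ j j′ m n} →
    interleave (factor x i m) (factor y j n) ≡ interleave (factor x i′ m) (factor y j′ n) →
    factor x i m ≡ factor x i′ m × factor y j n ≡ factor y j′ n
  interleave-factor-injective {x} {y} {i} {i′} {j} {j′} {m} {n} =
    interleave-injective (trans (length-factor x i m) (sym (length-factor x i′ m)))
                         (trans (length-factor y j n) (sym (length-factor y j′ n)))

  module _ {x a b : ℕ → A}
           (x-double : ∀ i → x (double i) ≡ a i) (x-suc-double : ∀ i → x (suc (double i)) ≡ b i) where

    factor-double     : ∀ i n → factor x (double i) n
                              ≡ interleave (factor a i ⌈ n /2⌉) (factor b i ⌊ n /2⌋)
    factor-suc-double : ∀ i n → factor x (suc (double i)) n
                              ≡ interleave (factor b i ⌈ n /2⌉) (factor a (suc i) ⌊ n /2⌋)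

    factor-double i zero    = refl
    factor-double i (suc n) = cong₂ _∷_ (x-double i) (factor-suc-double i n)

    factor-suc-double i zero    = refl
    factor-suc-double i (suc n) = cong₂ _∷_ (x-suc-double i) (factor-double (suc i) n)

factor-parity-cong : ∀ {i j} k → parity i ≡ parity j → factor (bit ∘ parity) i k ≡ factor (bit ∘ parity) j k
factor-parity-cong         zero    _  = refl
factor-parity-cong {i} {j} (suc k) eq = cong₂ _∷_ (cong bit eq) (factor-parity-cong k (parity-suc-cong {i} {j} eq))

-- Marked factors and their representatives

markedFactor : ℕ → ℕ → Parity × Word
markedFactor n i = parity i , factor paperfolding i n

≟-markedFactor : DecidableEquality (Parity × Word)
≟-markedFactor = ×-≡-dec ℙ._≟_ (List-≡-dec ℕ._≟_)

markedFactor-suc-double : ∀ m {i j} →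
  markedFactor (suc m) (suc (double i)) ≡ markedFactor (suc m) (suc (double j)) ⇔
  markedFactor ⌊ suc m /2⌋ (suc i) ≡ markedFactor ⌊ suc m /2⌋ (suc j)
markedFactor-suc-double m {i} {j} = mk⇔ to from
  where
  split : ∀ k → factor paperfolding (suc (double k)) (suc m)
              ≡ interleave (factor (bit ∘ parity) k ⌈ suc m /2⌉) (factor paperfolding (suc k) ⌊ suc m /2⌋)
  split k = factor-suc-double paperfolding-double paperfolding-suc-double k (suc m)

  to : markedFactor (suc m) (suc (double i)) ≡ markedFactor (suc m) (suc (double j)) →
       markedFactor ⌊ suc m /2⌋ (suc i) ≡ markedFactor ⌊ suc m /2⌋ (suc j)
  to eq with interleave-factor-injective (trans (sym (split i)) (trans (cong proj₂ eq) (split j)))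
  ... | bits≡ , factor≡ = cong₂ _,_ (parity-suc-cong {i} {j} (bit-injective (∷-injectiveˡ bits≡))) factor≡

  from : markedFactor ⌊ suc m /2⌋ (suc i) ≡ markedFactor ⌊ suc m /2⌋ (suc j) →
         markedFactor (suc m) (suc (double i)) ≡ markedFactor (suc m) (suc (double j))
  from eq = cong₂ _,_ (trans (parity-suc-double i) (sym (parity-suc-double j))) (begin
    factor paperfolding (suc (double i)) (suc m)
      ≡⟨ split i ⟩
    interleave (factor (bit ∘ parity) i ⌈ suc m /2⌉) (factor paperfolding (suc i) ⌊ suc m /2⌋)
      ≡⟨ cong₂ interleave (factor-parity-cong _ (parity-suc-injective {i} {j} (cong proj₁ eq))) (cong proj₂ eq) ⟩
    interleave (factor (bit ∘ parity) j ⌈ suc m /2⌉) (factor paperfolding (suc j) ⌊ suc m /2⌋)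
      ≡⟨ split j ⟨
    factor paperfolding (suc (double j)) (suc m) ∎)
    where open ≡-Reasoning

markedFactor-double : ∀ m {i j} →
  markedFactor (suc (suc m)) (double i) ≡ markedFactor (suc (suc m)) (double j) ⇔
  markedFactor ⌈ suc (suc m) /2⌉ i ≡ markedFactor ⌈ suc (suc m) /2⌉ j
markedFactor-double m {i} {j} = mk⇔ to from
  where
  split : ∀ k → factor paperfolding (double k) (suc (suc m))
              ≡ interleave (factor paperfolding k ⌈ suc (suc m) /2⌉) (factor (bit ∘ parity) k ⌊ suc (suc m) /2⌋)
  split k = factor-double paperfolding-double paperfolding-suc-double k (suc (suc m))

  to : markedFactor (suc (suc m)) (double i) ≡ markedFactor (suc (suc m)) (double j) →
       markedFactor ⌈ suc (suc m) /2⌉ i ≡ markedFactor ⌈ suc (suc m) /2⌉ j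
  to eq with interleave-factor-injective (trans (sym (split i)) (trans (cong proj₂ eq) (split j)))
  ... | factor≡ , bits≡ = cong₂ _,_ (bit-injective (∷-injectiveˡ bits≡)) factor≡

  from : markedFactor ⌈ suc (suc m) /2⌉ i ≡ markedFactor ⌈ suc (suc m) /2⌉ j →
         markedFactor (suc (suc m)) (double i) ≡ markedFactor (suc (suc m)) (double j)
  from eq = cong₂ _,_ (trans (parity-double i) (sym (parity-double j))) (begin
    factor paperfolding (double i) (suc (suc m))
      ≡⟨ split i ⟩
    interleave (factor paperfolding i ⌈ suc (suc m) /2⌉) (factor (bit ∘ parity) i ⌊ suc (suc m) /2⌋)
      ≡⟨ cong₂ interleave (cong proj₂ eq) (factor-parity-cong _ (cong proj₁ eq)) ⟩
    interleave (factor paperfolding j ⌈ suc (suc m) /2⌉) (factor (bit ∘ parity) j ⌊ suc (suc m) /2⌋)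
      ≡⟨ split j ⟨
    factor paperfolding (double j) (suc (suc m)) ∎)
    where open ≡-Reasoning

record Representatives {K : Set} (κ : ℕ → K) (L : List ℕ) : Set where
  field
    positive : All (1 ≤_) L
    distinct : Unique (map κ L)
    complete : ∀ i → 1 ≤ i → ∃ λ j → j ∈ L × κ i ≡ κ j

module _ {K K′ : Set} {κ : ℕ → K} {κ′ : ℕ → K′} where

  unique-map-reflect : ∀ {P : ℕ → Set} {L} → (∀ {i j} → P i → P j → κ′ i ≡ κ′ j → κ i ≡ κ j) →
    All P L → Unique (map κ L) → Unique (map κ′ L)
  unique-map-reflect reflect []        []             = []
  unique-map-reflect reflect (pᵢ ∷ ps) (κᵢ∉ ∷ unique) =
    AllP.map⁺ (All.zipWith (λ (κᵢ≢κⱼ , pⱼ) → κᵢ≢κⱼ ∘ reflect pᵢ pⱼ) (AllP.map⁻ κᵢ∉ , ps))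
    ∷ unique-map-reflect reflect ps unique

  representatives-transfer : ∀ {L} → (∀ {i j} → 1 ≤ i → 1 ≤ j → κ′ i ≡ κ′ j → κ i ≡ κ j) →
    (∀ {i j} → κ i ≡ κ j → κ′ i ≡ κ′ j) → Representatives κ L → Representatives κ′ L
  representatives-transfer reflect preserve R = record
    { positive = positive
    ; distinct = unique-map-reflect reflect positive distinct
    ; complete = λ i 1≤i → let j , j∈L , eq = complete i 1≤i in j , j∈L , preserve eq
    }
    where open Representatives R

representatives-lift : ∀ {K : Set} {κ : ℕ → K} {L} (Q : K → Set) → Representatives κ L →
  All (Q ∘ κ) L → ∀ {i} → 1 ≤ i → Q (κ i)
representatives-lift Q R Qs {i} 1≤i with Representatives.complete R i 1≤i
... | j , j∈L , eq = subst Q (sym eq) (All.lookup Qs j∈L)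

representatives₁ : Representatives (markedFactor 1) (1 ∷ 3 ∷ 2 ∷ 6 ∷ [])
representatives₁ = record
  { positive = s≤s z≤n ∷ s≤s z≤n ∷ s≤s z≤n ∷ s≤s z≤n ∷ []
  ; distinct = from-yes (unique? ≟-markedFactor (map (markedFactor 1) (1 ∷ 3 ∷ 2 ∷ 6 ∷ [])))
  ; complete = complete
  }
  where
  -- markedFactor 1 i is unfolded here so that the with-abstraction sees parity i and paperfolding i.
  complete : ∀ i → 1 ≤ i →
    ∃ λ j → j ∈ 1 ∷ 3 ∷ 2 ∷ 6 ∷ [] × (parity i , paperfolding i ∷ []) ≡ markedFactor 1 j
  complete i _ with parity i | paperfolding i | paperfolding≤1 i
  ... | 1ℙ | 0           | _       = 1 , here refl , refl
  ... | 1ℙ | 1           | _       = 3 , there (here refl) , refl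
  ... | 0ℙ | 0           | _       = 2 , there (there (here refl)) , refl
  ... | 0ℙ | 1           | _       = 6 , there (there (there (here refl))) , refl
  ... | _  | suc (suc _) | s≤s ()

representatives-step : ∀ m {A B} →
  Representatives (markedFactor ⌊ suc (suc m) /2⌋) A → Representatives (markedFactor ⌈ suc (suc m) /2⌉) B →
  Representatives (markedFactor (suc (suc m))) (map (pred ∘ double) A ++ map double B)
representatives-step m {A} {B} RA RB = record { positive = positive ; distinct = distinct ; complete = complete }
  where
  module RA = Representatives RA
  module RB = Representatives RB

  n : ℕ
  n = suc (suc m)

  positive : All (1 ≤_) (map (pred ∘ double) A ++ map double B)
  positive = AllP.++⁺ (AllP.map⁺ (All.map odd-positive RA.positive)) (AllP.map⁺ (All.map even-positive RB.positive))
    where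
    odd-positive : ∀ {i} → 1 ≤ i → 1 ≤ pred (double i)
    odd-positive (s≤s _) = s≤s z≤n
    even-positive : ∀ {i} → 1 ≤ i → 1 ≤ double i
    even-positive (s≤s _) = s≤s z≤n

  distinct : Unique (map (markedFactor n) (map (pred ∘ double) A ++ map double B))
  distinct rewrite map-++ (markedFactor n) (map (pred ∘ double) A) (map double B)
                 | sym (map-∘ {g = markedFactor n} {f = pred ∘ double} A)
                 | sym (map-∘ {g = markedFactor n} {f = double} B) =
    UniqueP.++⁺ (unique-map-reflect odd-reflect RA.positive RA.distinct)
                (unique-map-reflect (λ _ _ → Equivalence.to (markedFactor-double m)) RB.positive RB.distinct)
                disjoint
    where
    odd-reflect : ∀ {i j} → 1 ≤ i → 1 ≤ j →
      markedFactor n (pred (double i)) ≡ markedFactor n (pred (double j)) → markedFactor ⌊ n /2⌋ i ≡ markedFactor ⌊ n /2⌋ j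
    odd-reflect {suc _} {suc _} _ _ = Equivalence.to (markedFactor-suc-double (suc m))

    odd-parity : ∀ {i} → 1 ≤ i → parity (pred (double i)) ≡ 1ℙ
    odd-parity {suc i} _ = parity-suc-double i

    disjoint : ∀ {v} → ¬ (v ∈ map (markedFactor n ∘ pred ∘ double) A × v ∈ map (markedFactor n ∘ double) B)
    disjoint (v∈odd , v∈even)
      with ∈-map⁻ (markedFactor n ∘ pred ∘ double) v∈odd | ∈-map⁻ (markedFactor n ∘ double) v∈even
    ... | i , i∈A , refl | j , _ , eq =
      contradiction (trans (sym (odd-parity (All.lookup RA.positive i∈A))) (trans (cong proj₁ eq) (parity-double j))) λ ()

  complete : ∀ i → 1 ≤ i →
    ∃ λ j → j ∈ map (pred ∘ double) A ++ map double B × markedFactor n i ≡ markedFactor n j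
  complete i 1≤i with halfView i
  complete .(suc (double d)) _ | odd d with RA.complete (suc d) (s≤s z≤n)
  ... | suc e , e∈A , eq =
    suc (double e) , ∈-++⁺ˡ (∈-map⁺ (pred ∘ double) e∈A) , Equivalence.from (markedFactor-suc-double (suc m)) eq
  ... | zero  , 0∈A , _  = contradiction (All.lookup RA.positive 0∈A) λ ()
  complete .(double (suc d)) _ | even (suc d) with RB.complete (suc d) (s≤s z≤n)
  ... | e , e∈B , eq =
    double e , ∈-++⁺ʳ (map (pred ∘ double) A) (∈-map⁺ double e∈B) , Equivalence.from (markedFactor-double m) eq
  complete .(double zero) () | even zero

markedFactor-representatives : ∀ n → 1 ≤ n →
  Σ (List ℕ) λ L → length L ≡ 4 * n × Representatives (markedFactor n) L
markedFactor-representatives n = build n (<-wellFounded n)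
  where
  build : ∀ n → Acc _<_ n → 1 ≤ n → Σ (List ℕ) λ L → length L ≡ 4 * n × Representatives (markedFactor n) L
  build 1 _ _ = 1 ∷ 3 ∷ 2 ∷ 6 ∷ [] , refl , representatives₁
  build (suc (suc m)) (acc rec) _
    with build ⌊ suc (suc m) /2⌋ (rec (⌊n/2⌋<n (suc m))) (s≤s z≤n)
       | build ⌈ suc (suc m) /2⌉ (rec (⌈n/2⌉<n m)) (s≤s z≤n)
  ... | A , |A| , RA | B , |B| , RB = map (pred ∘ double) A ++ map double B , length≡ , representatives-step m RA RB
    where
    open ≡-Reasoning
    length≡ : length (map (pred ∘ double) A ++ map double B) ≡ 4 * suc (suc m)
    length≡ = begin
      length (map (pred ∘ double) A ++ map double B)
        ≡⟨ length-++ (map (pred ∘ double) A) ⟩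
      length (map (pred ∘ double) A) + length (map double B)
        ≡⟨ cong₂ _+_ (length-map (pred ∘ double) A) (length-map double B) ⟩
      length A + length B
        ≡⟨ cong₂ _+_ |A| |B| ⟩
      4 * ⌊ suc (suc m) /2⌋ + 4 * ⌈ suc (suc m) /2⌉
        ≡⟨ *-distribˡ-+ 4 ⌊ suc (suc m) /2⌋ ⌈ suc (suc m) /2⌉ ⟨
      4 * (⌊ suc (suc m) /2⌋ + ⌈ suc (suc m) /2⌉)
        ≡⟨ cong (4 *_) (⌊n/2⌋+⌈n/2⌉≡n (suc (suc m))) ⟩
      4 * suc (suc m) ∎

-- The tortoise map on binary words

deleteFirst : ℕ → Word → Word
deleteFirst n []      = []
deleteFirst n (x ∷ w) = if x ≡ᵇ n then w else x ∷ deleteFirst n w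

tortoiseJoin : ℕ → List Word → Word
tortoiseJoin n []       = []
tortoiseJoin n (A ∷ As) = A ++ concatMap (_∷ʳ n) As

[]≢∷ʳ : ∀ (w : Word) n → [] ≢ w ∷ʳ n
[]≢∷ʳ w n eq with ++-conicalʳ w [ n ] (sym eq)
... | ()

∈-tail : ∀ {x n w} → (x ≡ᵇ n) ≡ false → n ∈ x ∷ w → n ∈ w
∈-tail {x} x≢ᵇx (here refl) = ⊥-elim (subst T x≢ᵇx (≡⇒≡ᵇ x x refl))
∈-tail _        (there n∈w) = n∈w

splitOn-∷ʳ : ∀ n w → concatMap (_∷ʳ n) (splitOn n w) ≡ w ∷ʳ n
splitOn-∷ʳ n [] = refl
splitOn-∷ʳ n (x ∷ w) with x ≡ᵇ n in x≡ᵇn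
... | true = cong₂ _∷_ (sym (≡ᵇ⇒≡ x n (subst T (sym x≡ᵇn) tt))) (splitOn-∷ʳ n w)
... | false with splitOn n w | splitOn-∷ʳ n w
...   | []    | ih = ⊥-elim ([]≢∷ʳ w n ih)
...   | _ ∷ _ | ih = cong (x ∷_) ih

tortoiseJoin-splitOn : ∀ n w → n ∈ w → tortoiseJoin n (splitOn n w) ≡ deleteFirst n w ∷ʳ n
tortoiseJoin-splitOn n (x ∷ w) n∈ with x ≡ᵇ n in x≡ᵇn
... | true = splitOn-∷ʳ n w
... | false with splitOn n w | tortoiseJoin-splitOn n w (∈-tail x≡ᵇn n∈)
...   | []    | ih = ⊥-elim ([]≢∷ʳ (deleteFirst n w) n ih)
...   | _ ∷ _ | ih = cong (x ∷_) ih

deleteFirst-++ : ∀ {n u} v → n ∈ u → deleteFirst n (u ++ v) ≡ deleteFirst n u ++ v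
deleteFirst-++ {n} {x ∷ u} v n∈ with x ≡ᵇ n in x≡ᵇn
... | true  = refl
... | false = cong (x ∷_) (deleteFirst-++ v (∈-tail x≡ᵇn n∈))

length-deleteFirst : ∀ {n u} → n ∈ u → suc (length (deleteFirst n u)) ≡ length u
length-deleteFirst {n} {x ∷ u} n∈ with x ≡ᵇ n in x≡ᵇn
... | true  = refl
... | false = cong suc (length-deleteFirst (∈-tail x≡ᵇn n∈))

tortoiseF-unfold : ∀ k x w → tortoiseF (suc k) (x ∷ w)
  ≡ tortoiseJoin (maxLetter (x ∷ w)) (map (tortoiseF k) (splitOn (maxLetter (x ∷ w)) (x ∷ w)))
tortoiseF-unfold k x w with splitOn (maxLetter (x ∷ w)) (x ∷ w)
... | []     = refl
... | A ∷ As = cong (tortoiseF k A ++_) (sym (concatMap-map (_∷ʳ maxLetter (x ∷ w)) (tortoiseF k) As))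

tortoiseF-deleteFirst : ∀ k x w {m} → maxLetter (x ∷ w) ≡ m → m ∈ x ∷ w →
  All (λ B → tortoiseF k B ≡ B) (splitOn m (x ∷ w)) →
  tortoiseF (suc k) (x ∷ w) ≡ deleteFirst m (x ∷ w) ∷ʳ m
tortoiseF-deleteFirst k x w {m} max≡m m∈ fixed = begin
  tortoiseF (suc k) (x ∷ w)
    ≡⟨ tortoiseF-unfold k x w ⟩
  tortoiseJoin (maxLetter (x ∷ w)) (map (tortoiseF k) (splitOn (maxLetter (x ∷ w)) (x ∷ w)))
    ≡⟨ cong (λ c → tortoiseJoin c (map (tortoiseF k) (splitOn c (x ∷ w)))) max≡m ⟩
  tortoiseJoin m (map (tortoiseF k) (splitOn m (x ∷ w)))
    ≡⟨ cong (tortoiseJoin m) (map-id-local fixed) ⟩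
  tortoiseJoin m (splitOn m (x ∷ w))
    ≡⟨ tortoiseJoin-splitOn m (x ∷ w) m∈ ⟩
  deleteFirst m (x ∷ w) ∷ʳ m ∎
  where open ≡-Reasoning

tortoiseF-[] : ∀ k → tortoiseF k [] ≡ []
tortoiseF-[] zero    = refl
tortoiseF-[] (suc k) = refl

maxLetter-zeros : ∀ {A} → All (_≡ 0) A → maxLetter A ≡ 0
maxLetter-zeros []          = refl
maxLetter-zeros (refl ∷ zs) = maxLetter-zeros zs

splitOn-zeros : ∀ {A} → All (_≡ 0) A → All (_≡ []) (splitOn 0 A)
splitOn-zeros []          = refl ∷ []
splitOn-zeros (refl ∷ zs) = refl ∷ splitOn-zeros zs

zeros-∷ʳ : ∀ {A} → All (_≡ 0) A → A ∷ʳ 0 ≡ 0 ∷ A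
zeros-∷ʳ []          = refl
zeros-∷ʳ (refl ∷ zs) = cong (0 ∷_) (zeros-∷ʳ zs)

tortoiseF-zeros : ∀ k {A} → All (_≡ 0) A → tortoiseF k A ≡ A
tortoiseF-zeros zero    _                         = refl
tortoiseF-zeros (suc k) []                        = refl
tortoiseF-zeros (suc k) {0 ∷ A} zeros@(refl ∷ zs) =
  trans (tortoiseF-deleteFirst k 0 A (maxLetter-zeros zeros) (here refl)
                               (All.map (λ { refl → tortoiseF-[] k }) (splitOn-zeros zeros)))
        (zeros-∷ʳ zs)

maxLetter≤1 : ∀ {w} → All (_≤ 1) w → maxLetter w ≤ 1
maxLetter≤1 []         = z≤n
maxLetter≤1 (x≤1 ∷ bs) = ⊔-lub x≤1 (maxLetter≤1 bs)

maxLetter-binary : ∀ {w} → All (_≤ 1) w → 1 ∈ w → maxLetter w ≡ 1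
maxLetter-binary (z≤n ∷ bs)     (there 1∈) = maxLetter-binary bs 1∈
maxLetter-binary (s≤s z≤n ∷ bs) _          = m≥n⇒m⊔n≡m (maxLetter≤1 bs)

splitOn-binary : ∀ {w} → All (_≤ 1) w → All (All (_≡ 0)) (splitOn 1 w)
splitOn-binary []                     = [] ∷ []
splitOn-binary (s≤s z≤n ∷ bs)         = [] ∷ splitOn-binary bs
splitOn-binary {0 ∷ w} (z≤n ∷ bs) with splitOn 1 w | splitOn-binary bs
... | []    | []       = (refl ∷ []) ∷ []
... | _ ∷ _ | zs ∷ zss = (refl ∷ zs) ∷ zss

tortoise-binary : ∀ {w} → All (_≤ 1) w → 1 ∈ w → tortoise w ≡ deleteFirst 1 w ∷ʳ 1
tortoise-binary {x ∷ w} bs 1∈ =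
  tortoiseF-deleteFirst (length w) x w (maxLetter-binary bs 1∈) 1∈
                        (All.map (tortoiseF-zeros (length w)) (splitOn-binary bs))

-- Factors of length at least eight

++-injective : ∀ {A : Set} {xs xs′ ys ys′ : List A} → length xs ≡ length xs′ →
  xs ++ ys ≡ xs′ ++ ys′ → xs ≡ xs′ × ys ≡ ys′
++-injective {xs = []}    {[]}     _    eq = refl , eq
++-injective {xs = _ ∷ _} {_ ∷ _} |xs| eq with ∷-injective eq
... | x≡x′ , rest with ++-injective (suc-injective |xs|) rest
...   | xs≡xs′ , ys≡ys′ = cong₂ _∷_ x≡x′ xs≡xs′ , ys≡ys′

tortoise-factor-+ : ∀ {x : ℕ → ℕ} → (∀ i → x i ≤ 1) → ∀ {i} m k → 1 ∈ factor x i m →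
  tortoise (factor x i (m + k)) ≡ (deleteFirst 1 (factor x i m) ++ factor x (m + i) k) ∷ʳ 1
tortoise-factor-+ {x} x≤1 {i} m k 1∈ = begin
  tortoise (factor x i (m + k))
    ≡⟨ tortoise-binary (All-factor x≤1 i (m + k)) (subst (1 ∈_) (sym (factor-+ x i m k)) (∈-++⁺ˡ 1∈)) ⟩
  deleteFirst 1 (factor x i (m + k)) ∷ʳ 1
    ≡⟨ cong (λ w → deleteFirst 1 w ∷ʳ 1) (factor-+ x i m k) ⟩
  deleteFirst 1 (factor x i m ++ factor x (m + i) k) ∷ʳ 1
    ≡⟨ cong (_∷ʳ 1) (deleteFirst-++ (factor x (m + i) k) 1∈) ⟩
  (deleteFirst 1 (factor x i m) ++ factor x (m + i) k) ∷ʳ 1 ∎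
  where open ≡-Reasoning

TortoiseInjective : Parity × Word → Parity × Word → Set
TortoiseInjective u v = tortoise (proj₂ u) ≡ tortoise (proj₂ v) → u ≡ v

tortoise-injective-+ : ∀ {m} → (∀ {i} → 1 ≤ i → 1 ∈ factor paperfolding i m) →
  (∀ {i j} → 1 ≤ i → 1 ≤ j → TortoiseInjective (markedFactor m i) (markedFactor m j)) →
  ∀ k {i j} → 1 ≤ i → 1 ≤ j → TortoiseInjective (markedFactor (m + k) i) (markedFactor (m + k) j)
tortoise-injective-+ {m} 1∈ injective k {i} {j} 1≤i 1≤j eq = cong₂ _,_ (cong proj₁ prefix≡) (begin
  factor paperfolding i (m + k)                             ≡⟨ factor-+ paperfolding i m k ⟩
  factor paperfolding i m ++ factor paperfolding (m + i) k  ≡⟨ cong₂ _++_ (cong proj₂ prefix≡) (proj₂ split) ⟩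
  factor paperfolding j m ++ factor paperfolding (m + j) k  ≡⟨ factor-+ paperfolding j m k ⟨
  factor paperfolding j (m + k)                             ∎)
  where
  open ≡-Reasoning

  head : ℕ → Word
  head i = deleteFirst 1 (factor paperfolding i m)

  length-head : ∀ {i} → 1 ≤ i → suc (length (head i)) ≡ m
  length-head {i} 1≤i = trans (length-deleteFirst (1∈ 1≤i)) (length-factor paperfolding i m)

  split : head i ≡ head j × factor paperfolding (m + i) k ≡ factor paperfolding (m + j) k
  split = ++-injective (suc-injective (trans (length-head 1≤i) (sym (length-head 1≤j))))
    (∷ʳ-injectiveˡ _ _ (trans (sym (tortoise-factor-+ paperfolding≤1 m k (1∈ 1≤i)))
                       (trans eq (tortoise-factor-+ paperfolding≤1 m k (1∈ 1≤j)))))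

  tortoise-prefix : ∀ {i} → 1 ≤ i → tortoise (factor paperfolding i m) ≡ head i ∷ʳ 1
  tortoise-prefix {i} 1≤i = tortoise-binary (All-factor paperfolding≤1 i m) (1∈ 1≤i)

  prefix≡ : markedFactor m i ≡ markedFactor m j
  prefix≡ = injective 1≤i 1≤j
    (trans (tortoise-prefix 1≤i) (trans (cong (_∷ʳ 1) (proj₁ split)) (sym (tortoise-prefix 1≤j))))

positions₈ : List ℕ
positions₈ = proj₁ (markedFactor-representatives 8 (s≤s z≤n))

representatives₈ : Representatives (markedFactor 8) positions₈
representatives₈ = proj₂ (proj₂ (markedFactor-representatives 8 (s≤s z≤n)))

1∈factor₈ : ∀ {i} → 1 ≤ i → 1 ∈ factor paperfolding i 8
1∈factor₈ = representatives-lift (λ u → 1 ∈ proj₂ u) representatives₈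
  (from-yes (All.all? (λ r → 1 ∈? factor paperfolding r 8) positions₈))

tortoise-injective₈ : ∀ {i j} → 1 ≤ i → 1 ≤ j → TortoiseInjective (markedFactor 8 i) (markedFactor 8 j)
tortoise-injective₈ {i} 1≤i =
  representatives-lift (TortoiseInjective (markedFactor 8 i)) representatives₈
    (representatives-lift (λ u → All (TortoiseInjective u ∘ markedFactor 8) positions₈) representatives₈
                          (from-yes (All.all? (λ r → All.all? (tortoise-injective? r) positions₈) positions₈)) 1≤i)
  where
  tortoise-injective? : ∀ r s → Dec (TortoiseInjective (markedFactor 8 r) (markedFactor 8 s))
  tortoise-injective? r s = List-≡-dec ℕ._≟_ (tortoise (factor paperfolding r 8)) (tortoise (factor paperfolding s 8))
                            →-dec ≟-markedFactor (markedFactor 8 r) (markedFactor 8 s)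

theorem3 : (n : ℕ) → 8 ≤ n →
    Σ (List ℕ) λ is →
      length is ≡ 4 * n
      × All (λ i → 1 ≤ i) is
      × Unique (map (λ i → tortoise (factor paperfolding i n)) is)
      × ((i : ℕ) → 1 ≤ i → ∃ λ j → j ∈ is × (factor paperfolding i n ∼t factor paperfolding j n))
theorem3 n 8≤n with m≤n⇒∃[o]m+o≡n 8≤n
... | k , refl with markedFactor-representatives (8 + k) (s≤s z≤n)
... | L , |L| , R = L , |L| , positive , distinct , complete
  where
  open Representatives (representatives-transfer {κ′ = λ i → tortoise (factor paperfolding i (8 + k))}
    (tortoise-injective-+ 1∈factor₈ tortoise-injective₈ k) (cong (tortoise ∘ proj₂)) R)
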